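{- If $S_{p,r}$ is a split graph with ${\rm diam}(S_{p,r})=3$, then $\Gamma_{\rho}(S_{p,r})=\Delta(S_{p,r})+1$.
   Context: A split graph $S_{p,r}$ is a graph on $p+r$ vertices whose vertex set can be partitioned into a clique on $p$ vertices and an independent set on $r$ vertices. $\Delta$ denotes the maximum degree. $d(u,v)$ is graph distance. A packing coloring $c:V\to\{1,\dots,k\}$ satisfies: $c(u)=c(v)=i$, $u\ne v$, implies $d(u,v)>i$. The Grundy packing chromatic number $\Gamma_{\rho}(G)$ is the maximum number of colors $k$ in a packing coloring $c:V(G)\to\{1,\dots,k\}$ using all $k$ colors in which every vertex $v$ with $c(v)=i$ has, for every $j\in\{1,\dots,i-1\}$, a vertex $u$ with $c(u)=j$ and $d(u,v)\le j$ (equivalently, the maximum number of colors produced by the greedy procedure that processes vertices in some order and assigns each vertex the smallest color $i$ with no already-colored vertex of color $i$ at distance at most $i$). -}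

module Defs where

open import Data.Nat using (ℕ; zero; suc; _≤_; _<_; _⊔_)
open import Data.Fin using (Fin; _↑ˡ_; _↑ʳ_)
open import Data.Nat.Base using (_+_)
open import Data.List using (List; length; filter; map; foldr)
open import Data.List.Base using (allFin)
open import Data.Product using (Σ; ∃; _×_; _,_)
open import Relation.Nullary using (¬_; Dec)
open import Relation.Binary.PropositionalEquality using (_≡_; _≢_)

record Graph (n : ℕ) : Set₁ where
  field
    Adj    : Fin n → Fin n → Set
    adj?   : ∀ u v → Dec (Adj u v)
    sym    : ∀ {u v} → Adj u v → Adj v u
    irrefl : ∀ {u} → ¬ Adj u u
open Graph public

-- Dist≤ G k u v  :  there is a walk of length at most k from u to v,
-- i.e. d(u,v) ≤ k (graph distance; infinite if disconnected).
data Dist≤ {n : ℕ} (G : Graph n) : ℕ → Fin n → Fin n → Set where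
  here : ∀ {k v} → Dist≤ G k v v
  step : ∀ {k u w v} → Adj G u w → Dist≤ G k w v → Dist≤ G (suc k) u v

degree : ∀ {n} → Graph n → Fin n → ℕ
degree {n} G v = length (filter (adj? G v) (allFin n))

maxDegree : ∀ {n} → Graph n → ℕ
maxDegree {n} G = foldr _⊔_ 0 (map (degree G) (allFin n))

Diam3 : ∀ {n} → Graph n → Set
Diam3 {n} G = (∀ u v → Dist≤ G 3 u v) × (Σ (Fin n) λ u → Σ (Fin n) λ v → ¬ Dist≤ G 2 u v)

IsSplit : (p r : ℕ) → Graph (p + r) → Set
IsSplit p r G =
    (∀ (i j : Fin p) → i ≢ j → Adj G (i ↑ˡ r) (j ↑ˡ r))
  × (∀ (i j : Fin r) → ¬ Adj G (p ↑ʳ i) (p ↑ʳ j))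

IsPackingColoring : ∀ {n} → Graph n → ℕ → (Fin n → ℕ) → Set
IsPackingColoring {n} G k c =
    (∀ v → 1 ≤ c v × c v ≤ k)
  × (∀ i → 1 ≤ i → i ≤ k → Σ (Fin n) λ v → c v ≡ i)
  × (∀ u v → u ≢ v → c u ≡ c v → ¬ Dist≤ G (c u) u v)

IsGrundyPackingColoring : ∀ {n} → Graph n → ℕ → (Fin n → ℕ) → Set
IsGrundyPackingColoring {n} G k c =
    IsPackingColoring G k c
  × (∀ v j → 1 ≤ j → j < c v → Σ (Fin n) λ u → c u ≡ j × Dist≤ G j u v)

GrundyPackingChromatic : ∀ {n} → Graph n → ℕ → Set
GrundyPackingChromatic {n} G m =
    (Σ (Fin n → ℕ) λ c → IsGrundyPackingColoring G m c)
  × (∀ k c → IsGrundyPackingColoring G k c → k ≤ m)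

{-# OPTIONS --safe #-}

-- A clique vertex x of maximum degree Δ exists, because an independent vertex has
-- degree at most that of any of its neighbours, all of which lie in the clique.
-- Colouring x and its non-neighbours (an independent set) with 1 and the neighbours
-- of x with 2, …, Δ + 1 is a Grundy packing colouring: any two neighbours of x are
-- at distance at most 2 through x.  Conversely, in a Grundy packing colouring every
-- vertex of colour at least 2 has a neighbour of colour 1.  Hence a clique vertex of
-- colour 1, if there is one, is adjacent to vertices of all other colours; otherwise
-- all vertices of colour at least 2 lie in the clique, and the vertex of colour 2 is
-- adjacent to them and to a vertex of colour 1.  Either way, with k colours, some
-- vertex has k − 1 neighbours of distinct colours, so k ≤ Δ + 1.  Diameter 3 only
-- ensures Δ ≥ 1.
module Submission where

open import Defs
open import Data.Nat using (ℕ; _+_)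

open import Axiom.UniquenessOfIdentityProofs using (module Decidable⇒UIP)
open import Data.Fin as Fin using (Fin; toℕ; fromℕ<; _↑ˡ_; _↑ʳ_; splitAt; punchIn)
import Data.Fin.Properties as Fin
open import Data.Fin.Permutation.Components using (transpose; transpose-inverse)
open import Data.List using (List; _∷_; lookup; allFin; filter; map)
open import Data.List.Membership.Propositional using (_∈_)
open import Data.List.Membership.Propositional.Properties
  using (∈-filter⁺; ∈-filter⁻; ∈-allFin; ∈-lookup; ∈-map⁺; ∈-map⁻; foldr-selective)
import Data.List.Membership.Setoid.Properties as Membership
open import Data.List.Properties using (foldr-forcesᵇ)
import Data.List.Relation.Unary.All as All
open import Data.List.Relation.Unary.Any using (index)
open import Data.List.Relation.Unary.Any.Properties using (lookup-index)
open import Data.List.Relation.Unary.Unique.Propositional using (Unique)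
open import Data.List.Relation.Unary.Unique.Propositional.Properties using (filter⁺; allFin⁺)
open import Data.Nat as ℕ using (suc; _≤_; _<_; z≤n; s≤s)
import Data.Nat.Properties as ℕ
open import Data.Product using (Σ; _×_; _,_; proj₁; proj₂)
open import Data.Sum using (_⊎_; inj₁; inj₂)
open import Function using (_∘_)
open import Function.Definitions using (Injective)
open import Relation.Nullary using (¬_; yes; no; contradiction)
open import Relation.Binary.PropositionalEquality as ≡ using (_≡_; _≢_; refl; cong; subst)
open ≡.≡-Reasoning

index-∈-lookup : ∀ {A : Set} (xs : List A) i → index (∈-lookup {xs = xs} i) ≡ i
index-∈-lookup (x ∷ xs) Fin.zero    = refl
index-∈-lookup (x ∷ xs) (Fin.suc i) = cong Fin.suc (index-∈-lookup xs i)

∈-irrelevant : ∀ {n} {xs : List (Fin n)} → Unique xs → {y : Fin n} (p q : y ∈ xs) → p ≡ q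
∈-irrelevant = Membership.unique⇒irrelevant (≡.setoid _) (Decidable⇒UIP.≡-irrelevant Fin._≟_)

module Neighbourhood {n : ℕ} (G : Graph n) (x : Fin n) where

  neighbours : List (Fin n)
  neighbours = filter (adj? G x) (allFin n)

  neighbours-unique : Unique neighbours
  neighbours-unique = filter⁺ (adj? G x) (allFin⁺ n)

  ∈neighbours : ∀ {y} → Adj G x y → y ∈ neighbours
  ∈neighbours a = ∈-filter⁺ (adj? G x) (∈-allFin _) a

  rank : ∀ {y} → Adj G x y → Fin (degree G x)
  rank a = index (∈neighbours a)

  unrank : Fin (degree G x) → Fin n
  unrank = lookup neighbours

  unrank-adj : ∀ i → Adj G x (unrank i)
  unrank-adj i = proj₂ (∈-filter⁻ (adj? G x) {xs = allFin n} (∈-lookup i))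

  unrank-rank : ∀ {y} (a : Adj G x y) → unrank (rank a) ≡ y
  unrank-rank a = ≡.sym (lookup-index (∈neighbours a))

  rank-cong : ∀ {y y'} → y ≡ y' → (a : Adj G x y) (b : Adj G x y') → rank a ≡ rank b
  rank-cong refl a b = cong index (∈-irrelevant neighbours-unique (∈neighbours a) (∈neighbours b))

  rank-unrank : ∀ i → rank (unrank-adj i) ≡ i
  rank-unrank i = begin
    rank (unrank-adj i)                  ≡⟨ cong index (∈-irrelevant neighbours-unique _ _) ⟩
    index (∈-lookup {xs = neighbours} i) ≡⟨ index-∈-lookup neighbours i ⟩
    i                                    ∎

  rank-injective : ∀ {y y'} (a : Adj G x y) (b : Adj G x y') → rank a ≡ rank b → y ≡ y'
  rank-injective a b e = ≡.trans (≡.sym (unrank-rank a)) (≡.trans (cong unrank e) (unrank-rank b))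

  unrank-injective : Injective _≡_ _≡_ unrank
  unrank-injective {i} {j} e = begin
    i                   ≡⟨ ≡.sym (rank-unrank i) ⟩
    rank (unrank-adj i) ≡⟨ rank-cong e (unrank-adj i) (unrank-adj j) ⟩
    rank (unrank-adj j) ≡⟨ rank-unrank j ⟩
    j                   ∎

  injective⇒≤degree : ∀ {m} (f : Fin m → Fin n) → Injective _≡_ _≡_ f →
                      (∀ i → Adj G x (f i)) → m ≤ degree G x
  injective⇒≤degree f f-injective adj =
    Fin.injective⇒≤ {f = rank ∘ adj} (f-injective ∘ rank-injective (adj _) (adj _))

  1≤degree⇒neighbour : 1 ≤ degree G x → Σ (Fin n) (Adj G x)
  1≤degree⇒neighbour 0<d = unrank (fromℕ< 0<d) , unrank-adj _

  neighbour⇒1≤degree : ∀ {y} → Adj G x y → 1 ≤ degree G x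
  neighbour⇒1≤degree a = ℕ.≤-trans (s≤s z≤n) (Fin.toℕ<n (rank a))

module _ {n : ℕ} (G : Graph n) where

  Dist≤1⇒≡⊎Adj : ∀ {u v} → Dist≤ G 1 u v → u ≡ v ⊎ Adj G u v
  Dist≤1⇒≡⊎Adj here          = inj₁ refl
  Dist≤1⇒≡⊎Adj (step a here) = inj₂ a

  Adj⇒Dist≤ : ∀ {k u v} → 1 ≤ k → Adj G u v → Dist≤ G k u v
  Adj⇒Dist≤ (s≤s _) a = step a here

  degree≤maxDegree : ∀ v → degree G v ≤ maxDegree G
  degree≤maxDegree v = All.lookup all≤Δ (∈-map⁺ (degree G) (∈-allFin v))
    where
    all≤Δ = foldr-forcesᵇ {P = _≤ maxDegree G}
      (λ d e d⊔e≤Δ → ℕ.m⊔n≤o⇒m≤o d e d⊔e≤Δ , ℕ.m⊔n≤o⇒n≤o d e d⊔e≤Δ)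
      0 (map (degree G) (allFin n)) ℕ.≤-refl

  maxDegree-attained : 1 ≤ maxDegree G → Σ (Fin n) λ v → degree G v ≡ maxDegree G
  maxDegree-attained 0<Δ with foldr-selective ℕ.⊔-sel 0 (map (degree G) (allFin n))
  ... | inj₁ Δ≡0 = contradiction Δ≡0 (ℕ.m<n⇒n≢0 0<Δ)
  ... | inj₂ Δ∈  with ∈-map⁻ (degree G) Δ∈
  ...   | v , _ , Δ≡degree = v , ≡.sym Δ≡degree

  open Neighbourhood G

  neighbourhood-embedding⇒degree≤ : ∀ {u v} (f : Fin n → Fin n) → Injective _≡_ _≡_ f →
                                    (∀ {w} → Adj G u w → Adj G v (f w)) → degree G u ≤ degree G v
  neighbourhood-embedding⇒degree≤ {u} {v} f f-injective f-adj =
    injective⇒≤degree v (f ∘ unrank u) (unrank-injective u ∘ f-injective) (f-adj ∘ unrank-adj u)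

  Diam3⇒1≤maxDegree : Diam3 G → 1 ≤ maxDegree G
  Diam3⇒1≤maxDegree (≤3 , u , v , ≰2) with ≤3 u v
  ... | here     = contradiction here ≰2
  ... | step a _ = ℕ.≤-trans (neighbour⇒1≤degree u a) (degree≤maxDegree u)

  module _ {k : ℕ} {c : Fin n → ℕ} where

    vertex-coloured : IsPackingColoring G k c → (i : Fin k) → Σ (Fin n) λ v → c v ≡ suc (toℕ i)
    vertex-coloured (_ , surjective , _) i = surjective (suc (toℕ i)) (s≤s z≤n) (Fin.toℕ<n i)

    adj⇒colours-differ : IsPackingColoring G k c → ∀ {u v} → Adj G u v → c u ≢ c v
    adj⇒colours-differ (inRange , _ , packing) {u} {v} a cu≡cv =
      packing u v (λ { refl → irrefl G a }) cu≡cv (Adj⇒Dist≤ (proj₁ (inRange u)) a)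

    colour≥2⇒colour-1-neighbour : IsGrundyPackingColoring G k c →
                                  ∀ y → 2 ≤ c y → Σ (Fin n) λ z → c z ≡ 1 × Adj G z y
    colour≥2⇒colour-1-neighbour (_ , grundy) y 2≤cy with grundy y 1 ℕ.≤-refl 2≤cy
    ... | z , cz≡1 , z≤1y with Dist≤1⇒≡⊎Adj z≤1y
    ...   | inj₁ refl = contradiction (≡.sym cz≡1) (ℕ.<⇒≢ 2≤cy)
    ...   | inj₂ a    = z , cz≡1 , a

  sees-all-colours-but-one⇒≤degree :
    ∀ {k} (c : Fin n → ℕ) x (j : Fin (suc k)) →
    (∀ i → i ≢ j → Σ (Fin n) λ y → c y ≡ suc (toℕ i) × Adj G x y) → k ≤ degree G x
  sees-all-colours-but-one⇒≤degree c x j sees =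
    injective⇒≤degree x witness witness-injective (proj₂ ∘ proj₂ ∘ seen)
    where
    seen = λ i → sees (punchIn j i) (Fin.punchInᵢ≢i j i)
    witness = proj₁ ∘ seen
    witness-injective : Injective _≡_ _≡_ witness
    witness-injective {i} {i'} e =
      Fin.punchIn-injective j i i' (Fin.toℕ-injective (ℕ.suc-injective (begin
        suc (toℕ (punchIn j i))  ≡⟨ ≡.sym (proj₁ (proj₂ (seen i))) ⟩
        c (witness i)            ≡⟨ cong c e ⟩
        c (witness i')           ≡⟨ proj₁ (proj₂ (seen i')) ⟩
        suc (toℕ (punchIn j i')) ∎)))

module NeighbourhoodColouring {n : ℕ} (G : Graph n) (x : Fin n) where

  open Neighbourhood G x

  colour : Fin n → ℕ
  colour y with adj? G x y
  ... | yes a = 2 + toℕ (rank a)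
  ... | no _  = 1

  colour-adj : ∀ {y} (a : Adj G x y) → colour y ≡ 2 + toℕ (rank a)
  colour-adj {y} a with adj? G x y
  ... | yes a' = cong (λ i → 2 + toℕ i) (rank-cong refl a' a)
  ... | no ¬a  = contradiction a ¬a

  colour-¬adj : ∀ {y} → ¬ Adj G x y → colour y ≡ 1
  colour-¬adj {y} ¬a with adj? G x y
  ... | yes a = contradiction a ¬a
  ... | no _  = refl

  neighbour-coloured : ∀ t → t < degree G x → Σ (Fin n) λ y → Adj G x y × colour y ≡ 2 + t
  neighbour-coloured t t<d = unrank i , unrank-adj i , (begin
    colour (unrank i)             ≡⟨ colour-adj (unrank-adj i) ⟩
    2 + toℕ (rank (unrank-adj i)) ≡⟨ cong (λ j → 2 + toℕ j) (rank-unrank i) ⟩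
    2 + toℕ i                     ≡⟨ cong (2 +_) (Fin.toℕ-fromℕ< t<d) ⟩
    2 + t                         ∎)
    where i = fromℕ< t<d

  colour-inRange : ∀ v → 1 ≤ colour v × colour v ≤ suc (degree G x)
  colour-inRange v with adj? G x v
  ... | yes a = s≤s z≤n , s≤s (Fin.toℕ<n (rank a))
  ... | no _  = s≤s z≤n , s≤s z≤n

  colour-surjective : ∀ i → 1 ≤ i → i ≤ suc (degree G x) → Σ (Fin n) λ v → colour v ≡ i
  colour-surjective 1             _ _         = x , colour-¬adj (irrefl G)
  colour-surjective (suc (suc t)) _ (s≤s t<d) with neighbour-coloured t t<d
  ... | y , _ , cy≡2+t = y , cy≡2+t

  colour-packing : (∀ {u v} → ¬ Adj G x u → ¬ Adj G x v → ¬ Adj G u v) →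
                   ∀ u v → u ≢ v → colour u ≡ colour v → ¬ Dist≤ G (colour u) u v
  colour-packing independent u v u≢v cu≡cv u~v with adj? G x u | adj? G x v
  ... | yes a | yes b = u≢v (rank-injective a b (Fin.toℕ-injective (ℕ.+-cancelˡ-≡ 2 _ _ cu≡cv)))
  ... | yes _ | no _  = contradiction cu≡cv λ ()
  ... | no _  | yes _ = contradiction cu≡cv λ ()
  ... | no ¬a | no ¬b with Dist≤1⇒≡⊎Adj G u~v
  ...   | inj₁ u≡v = u≢v u≡v
  ...   | inj₂ a   = independent ¬a ¬b a

  colour-grundy : ∀ v j → 1 ≤ j → j < colour v →
                  Σ (Fin n) λ u → colour u ≡ j × Dist≤ G j u v
  colour-grundy v j 1≤j j<cv with adj? G x v
  ... | no _  = contradiction 1≤j (ℕ.<⇒≱ j<cv)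
  ... | yes a = nearby j 1≤j j<cv
    where
    nearby : ∀ j → 1 ≤ j → j < 2 + toℕ (rank a) →
             Σ (Fin n) λ u → colour u ≡ j × Dist≤ G j u v
    nearby 1             _ _               = x , colour-¬adj (irrefl G) , step a here
    nearby (suc (suc t)) _ (s≤s (s≤s t<r))
      with neighbour-coloured t (ℕ.<-trans t<r (Fin.toℕ<n (rank a)))
    ... | y , b , cy≡2+t = y , cy≡2+t , step (sym G b) (step a here)

  colour-isGrundyPackingColoring : (∀ {u v} → ¬ Adj G x u → ¬ Adj G x v → ¬ Adj G u v) →
                                   IsGrundyPackingColoring G (suc (degree G x)) colour
  colour-isGrundyPackingColoring independent =
    (colour-inRange , colour-surjective , colour-packing independent) , colour-grundy

module SplitGraph (p r : ℕ) (G : Graph (p + r)) (split : IsSplit p r G) where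

  V : Set
  V = Fin (p + r)

  InClique : V → Set
  InClique v = Σ (Fin p) λ i → v ≡ i ↑ˡ r

  InIndependentSet : V → Set
  InIndependentSet v = Σ (Fin r) λ j → v ≡ p ↑ʳ j

  clique⊎independent : ∀ v → InClique v ⊎ InIndependentSet v
  clique⊎independent v with splitAt p v in eq
  ... | inj₁ i = inj₁ (i , ≡.sym (Fin.splitAt⁻¹-↑ˡ eq))
  ... | inj₂ j = inj₂ (j , ≡.sym (Fin.splitAt⁻¹-↑ʳ eq))

  clique-adj : ∀ {u v} → InClique u → InClique v → u ≢ v → Adj G u v
  clique-adj (i , refl) (j , refl) u≢v = proj₁ split i j (u≢v ∘ cong (_↑ˡ r))

  independent-¬adj : ∀ {u v} → InIndependentSet u → InIndependentSet v → ¬ Adj G u v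
  independent-¬adj (i , refl) (j , refl) = proj₂ split i j

  independent-neighbour∈clique : ∀ {u v} → InIndependentSet u → Adj G u v → InClique v
  independent-neighbour∈clique {v = v} iu a with clique⊎independent v
  ... | inj₁ kv = kv
  ... | inj₂ iv = contradiction a (independent-¬adj iu iv)

  clique-non-neighbour : ∀ {x u} → InClique x → ¬ Adj G x u → x ≡ u ⊎ InIndependentSet u
  clique-non-neighbour {x} {u} kx ¬xu with clique⊎independent u
  ... | inj₂ iu = inj₂ iu
  ... | inj₁ ku with x Fin.≟ u
  ...   | yes x≡u = inj₁ x≡u
  ...   | no x≢u  = contradiction (clique-adj kx ku x≢u) ¬xu

  clique-non-neighbours-independent : ∀ {x} → InClique x →
    ∀ {u v} → ¬ Adj G x u → ¬ Adj G x v → ¬ Adj G u v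
  clique-non-neighbours-independent kx ¬xu ¬xv uv
    with clique-non-neighbour kx ¬xu | clique-non-neighbour kx ¬xv
  ... | inj₁ refl | _         = ¬xv uv
  ... | _         | inj₁ refl = ¬xu (sym G uv)
  ... | inj₂ iu   | inj₂ iv   = independent-¬adj iu iv uv

  degree≤neighbour-degree : ∀ {v y} → InIndependentSet v → Adj G v y → degree G v ≤ degree G y
  degree≤neighbour-degree {v} {y} iv vy =
    neighbourhood-embedding⇒degree≤ G (transpose v y) transpose-injective swapped-adj
    where
    transpose-injective : Injective _≡_ _≡_ (transpose v y)
    transpose-injective {w} {w'} e = begin
      w                                ≡⟨ ≡.sym (transpose-inverse y v) ⟩
      transpose y v (transpose v y w)  ≡⟨ cong (transpose y v) e ⟩
      transpose y v (transpose v y w') ≡⟨ transpose-inverse y v ⟩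
      w'                               ∎
    swapped-adj : ∀ {w} → Adj G v w → Adj G y (transpose v y w)
    swapped-adj {w} vw with w Fin.≟ v
    ... | yes refl = contradiction vw (irrefl G)
    ... | no _ with w Fin.≟ y
    ...   | yes _  = sym G vy
    ...   | no w≢y = clique-adj (independent-neighbour∈clique iv vy)
                                (independent-neighbour∈clique iv vw) (w≢y ∘ ≡.sym)

  maxDegree-attained-in-clique : 1 ≤ maxDegree G → Σ V λ x → InClique x × degree G x ≡ maxDegree G
  maxDegree-attained-in-clique 0<Δ with maxDegree-attained G 0<Δ
  ... | v , dv≡Δ with clique⊎independent v
  ...   | inj₁ kv = v , kv , dv≡Δ
  ...   | inj₂ iv with Neighbourhood.1≤degree⇒neighbour G v (subst (1 ≤_) (≡.sym dv≡Δ) 0<Δ)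
  ...     | y , vy = y , independent-neighbour∈clique iv vy , ℕ.≤-antisym (degree≤maxDegree G y)
                           (subst (_≤ degree G y) dv≡Δ (degree≤neighbour-degree iv vy))

  module _ {k : ℕ} {c : V → ℕ} (grundy : IsGrundyPackingColoring G (suc k) c) where

    private
      packing = proj₁ grundy

    independent-colour≥2⇒colour-1-clique-neighbour :
      ∀ {y} → InIndependentSet y → 2 ≤ c y → Σ V λ z → c z ≡ 1 × InClique z × Adj G z y
    independent-colour≥2⇒colour-1-clique-neighbour {y} iy 2≤cy
      with colour≥2⇒colour-1-neighbour G grundy y 2≤cy
    ... | z , cz≡1 , zy = z , cz≡1 , independent-neighbour∈clique iy (sym G zy) , zy

    colour-1-clique-vertex-adj : ∀ {x y} → InClique x → c x ≡ 1 → 2 ≤ c y → Adj G x y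
    colour-1-clique-vertex-adj {x} {y} kx cx≡1 2≤cy with clique⊎independent y
    ... | inj₁ ky = clique-adj kx ky λ { refl → ℕ.<⇒≢ 2≤cy (≡.sym cx≡1) }
    ... | inj₂ iy with independent-colour≥2⇒colour-1-clique-neighbour iy 2≤cy
    ...   | z , cz≡1 , kz , zy with z Fin.≟ x
    ...     | yes refl = zy
    ...     | no z≢x   =
      contradiction (≡.trans cz≡1 (≡.sym cx≡1)) (adj⇒colours-differ G packing (clique-adj kz kx z≢x))

    clique-vertex-coloured-1⇒k≤maxDegree : ∀ {x} → InClique x → c x ≡ 1 → k ≤ maxDegree G
    clique-vertex-coloured-1⇒k≤maxDegree {x} kx cx≡1 =
      ℕ.≤-trans (sees-all-colours-but-one⇒≤degree G c x Fin.zero sees) (degree≤maxDegree G x)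
      where
      sees : ∀ i → i ≢ Fin.zero → Σ V λ y → c y ≡ suc (toℕ i) × Adj G x y
      sees Fin.zero    i≢0 = contradiction refl i≢0
      sees (Fin.suc i) _ with vertex-coloured G packing (Fin.suc i)
      ... | y , cy =
        y , cy , colour-1-clique-vertex-adj kx cx≡1 (subst (2 ≤_) (≡.sym cy) (s≤s (s≤s z≤n)))

    colour≥2-in-clique : (∀ {x} → InClique x → c x ≢ 1) → ∀ {y} → 2 ≤ c y → InClique y
    colour≥2-in-clique no-clique-1 {y} 2≤cy with clique⊎independent y
    ... | inj₁ ky = ky
    ... | inj₂ iy with independent-colour≥2⇒colour-1-clique-neighbour iy 2≤cy
    ...   | z , cz≡1 , kz , _ = contradiction cz≡1 (no-clique-1 kz)

  no-clique-vertex-coloured-1⇒k≤maxDegree :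
    ∀ {k c} → IsGrundyPackingColoring G (suc (suc k)) c →
    (∀ {x} → InClique x → c x ≢ 1) → suc k ≤ maxDegree G
  no-clique-vertex-coloured-1⇒k≤maxDegree {c = c} grundy no-clique-1 =
    ℕ.≤-trans (sees-all-colours-but-one⇒≤degree G c b (Fin.suc Fin.zero) sees) (degree≤maxDegree G b)
    where
    packing = proj₁ grundy
    b-cb = vertex-coloured G packing (Fin.suc Fin.zero)
    b = proj₁ b-cb
    2≤cb : 2 ≤ c b
    2≤cb = subst (2 ≤_) (≡.sym (proj₂ b-cb)) ℕ.≤-refl
    kb = colour≥2-in-clique grundy no-clique-1 2≤cb
    sees : ∀ i → i ≢ Fin.suc Fin.zero → Σ V λ y → c y ≡ suc (toℕ i) × Adj G b y
    sees Fin.zero _ with colour≥2⇒colour-1-neighbour G grundy b 2≤cb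
    ... | z , cz≡1 , zb = z , cz≡1 , sym G zb
    sees (Fin.suc Fin.zero) i≢1 = contradiction refl i≢1
    sees i@(Fin.suc (Fin.suc _)) _ with vertex-coloured G packing i
    ... | y , cy =
      y , cy , clique-adj kb (colour≥2-in-clique grundy no-clique-1 (ℕ.<⇒≤ 3≤cy)) b≢y
      where
      3≤cy : 3 ≤ c y
      3≤cy = subst (3 ≤_) (≡.sym cy) (s≤s (s≤s (s≤s z≤n)))
      b≢y : b ≢ y
      b≢y refl = ℕ.<⇒≢ 3≤cy (≡.sym (proj₂ b-cb))

  grundy-colours≤1+maxDegree : ∀ {k c} → IsGrundyPackingColoring G k c → k ≤ suc (maxDegree G)
  grundy-colours≤1+maxDegree {ℕ.zero} _ = z≤n
  grundy-colours≤1+maxDegree {suc k} {c} grundy with Fin.any? (λ i → c (i ↑ˡ r) ℕ.≟ 1)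
  ... | yes (i , c≡1) = s≤s (clique-vertex-coloured-1⇒k≤maxDegree grundy (i , refl) c≡1)
  grundy-colours≤1+maxDegree {1}           _      | no _ = s≤s z≤n
  grundy-colours≤1+maxDegree {suc (suc k)} grundy | no no-clique-1 =
    s≤s (no-clique-vertex-coloured-1⇒k≤maxDegree grundy λ { (i , refl) c≡1 → no-clique-1 (i , c≡1) })

  grundyPackingChromatic : 1 ≤ maxDegree G → GrundyPackingChromatic G (suc (maxDegree G))
  grundyPackingChromatic 0<Δ with maxDegree-attained-in-clique 0<Δ
  ... | x , kx , dx≡Δ =
    (colour , subst (λ d → IsGrundyPackingColoring G (suc d) colour) dx≡Δ
                    (colour-isGrundyPackingColoring (clique-non-neighbours-independent kx))) ,
    λ _ _ → grundy-colours≤1+maxDegree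
    where open NeighbourhoodColouring G x

corollary15 : (p r : ℕ) (G : Graph (p + r)) → IsSplit p r G → Diam3 G →
    GrundyPackingChromatic G (maxDegree G + 1)
corollary15 p r G split diam3 =
  subst (GrundyPackingChromatic G) (ℕ.+-comm 1 (maxDegree G))
        (SplitGraph.grundyPackingChromatic p r G split (Diam3⇒1≤maxDegree G diam3))
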